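{- Let $A$ and $B$ be nonzero integers, let $g=\gcd(A,B)$ and write $A=ga$, $B=gb$ with $\gcd(a,b)=1$. For an integer $L\ge 2$, let $\ell=\prod_{p\nmid g}p^{\nu_p(L)}$ and $\gamma(L)=\max_{p\mid g}\lceil \nu_p(L)/\nu_p(g)\rceil$ (with $\gamma(L)=0$ if $g=1$). Then the following are equivalent: (1) $L\in G_{(A,B)}$; (2) there exists a positive integer $\kappa\ge\gamma(L)$ with $\ell\mid (a^\kappa+b^\kappa)$; (3) $\ell\in G_{(a,b)}$.
   Context: For nonzero integers $X,Y$, a positive integer $M$ is good with respect to $X$ and $Y$ if there is a positive integer $K$ with $M\mid (X^K+Y^K)$; $G_{(X,Y)}$ denotes the set of such good integers. $\nu_p$ denotes the $p$-adic valuation; the product defining $\ell$ is over primes not dividing $g$ and the maximum defining $\gamma(L)$ is over primes dividing $g$. -}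

module Defs where

open import Data.Nat using (ℕ; zero; suc; _+_; _*_; _∸_; _/_; _⊔_)
import Data.Nat as ℕ
open import Data.Nat.Divisibility using (_∣?_)
open import Data.Nat.Primality using (prime?)
open import Data.Integer using (ℤ; +_; _^_) renaming (_+_ to _+ℤ_)
open import Data.Integer.Divisibility using () renaming (_∣_ to _∣ℤ_)
open import Data.List using (List; upTo; foldr)
open import Data.Product using (Σ; _×_)
open import Relation.Nullary using (yes; no; ¬_)
open import Relation.Nullary.Decidable using (⌊_⌋)
open import Data.Bool using (Bool; true; false; if_then_else_; _∧_; not)

Good : ℤ → ℤ → ℕ → Set
Good X Y M = Σ ℕ λ K → (1 ℕ.≤ K) × ((+ M) ∣ℤ ((X ^ K) +ℤ (Y ^ K)))

-- p-adic valuation with fuel: number of times p divides n (for p ≥ 2, n ≥ 1).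
-- Conventions for degenerate inputs (p < 2 or n = 0) give 0; never used.
νF : ℕ → ℕ → ℕ → ℕ
νF zero p n = 0
νF (suc f) zero n = 0
νF (suc f) (suc zero) n = 0
νF (suc f) p@(suc (suc q)) zero = 0
νF (suc f) p@(suc (suc q)) n@(suc _) with p ∣? n
... | yes _ = suc (νF f p (n / p))
... | no  _ = 0

-- ν p n = ν_p(n); fuel n suffices since ν_p(n) ≤ n.
ν : ℕ → ℕ → ℕ
ν p n = νF n p n

⌈_/_⌉ : ℕ → ℕ → ℕ
⌈ m / zero ⌉ = 0
⌈ m / suc k ⌉ = (m + k) / suc k

prodOver : List ℕ → (ℕ → ℕ) → ℕ
prodOver xs f = foldr (λ p acc → f p * acc) 1 xs

maxOver : List ℕ → (ℕ → ℕ) → ℕ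
maxOver xs f = foldr (λ p acc → f p ⊔ acc) 0 xs

isPrime : ℕ → Bool
isPrime p = ⌊ prime? p ⌋

divides : ℕ → ℕ → Bool
divides p n = ⌊ p ∣? n ⌋

-- ℓ = ∏_{p prime, p ∤ g} p^{ν_p(L)} ; only primes p ≤ L can contribute
-- (for other primes ν_p(L) = 0), so the product ranges over primes p < L + 1.
ell : ℕ → ℕ → ℕ
ell g L = prodOver (upTo (suc L))
  (λ p → if isPrime p ∧ not (divides p g) then p ℕ.^ ν p L else 1)

-- γ(L) = max_{p prime, p ∣ g} ⌈ν_p(L) / ν_p(g)⌉ (0 if g = 1); primes dividing
-- g ≥ 1 satisfy p ≤ g, so the max ranges over primes p < g + 1.
γ : ℕ → ℕ → ℕ
γ g L = maxOver (upTo (suc g))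
  (λ p → if isPrime p ∧ divides p g then ⌈ ν p L / ν p g ⌉ else 0)

{-# OPTIONS --safe #-}
module Submission where

-- Since A = g a and B = g b, we have A^K + B^K = g^K (a^K + b^K). The part ℓ of L is a
-- divisor of L coprime to g, so L ∣ A^K + B^K forces ℓ ∣ a^K + b^K. Conversely, once
-- κ ≥ γ(L) every prime power p^ν_p(L) with p ∣ g divides g^κ, so L ∣ g^κ ℓ and then
-- ℓ ∣ a^κ + b^κ gives L ∣ A^κ + B^κ. The lower bound on κ costs nothing: x + y divides
-- x^m + y^m for odd m, so an exponent K can be replaced by K (2 γ(L) + 1).

open import Defs

module PrimePowers where

  open import Data.Bool using (if_then_else_; _∧_; not)
  open import Data.List using ([]; _∷_; upTo)
  open import Data.List.Membership.Propositional using (_∈_)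
  open import Data.List.Membership.Propositional.Properties using (∈-upTo⁺)
  open import Data.List.Relation.Unary.All using (lookup; _∷_)
  open import Data.List.Relation.Unary.AllPairs using ([]; _∷_)
  open import Data.List.Relation.Unary.Any using (here; there)
  open import Data.List.Relation.Unary.Unique.Propositional using (Unique)
  open import Data.List.Relation.Unary.Unique.Propositional.Properties using (upTo⁺)
  open import Data.Nat
  open import Data.Nat.Coprimality as Coprimality using (Coprime; coprime-divisor; 1-coprimeTo)
  open import Data.Nat.Divisibility hiding (divides)
  open import Data.Nat.DivMod
  open import Data.Nat.Induction using (<-wellFounded)
  open import Data.Nat.ListAction using (product)
  open import Data.Nat.Primality
  open import Data.Nat.Primality.Factorisation using (factorise)
  open import Data.Nat.Properties
  open import Data.Product using (∃; _×_; _,_)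
  open import Data.Sum using (_⊎_; inj₁; inj₂)
  open import Function using (_∘_)
  open import Induction.WellFounded using (Acc; acc)
  open import Relation.Binary.PropositionalEquality
  open import Relation.Nullary using (yes; no; ¬_; contradiction)

  ^-monoʳ-∣ : ∀ p {m n} → m ≤ n → p ^ m ∣ p ^ n
  ^-monoʳ-∣ p {n = n} z≤n = 1∣ (p ^ n)
  ^-monoʳ-∣ p (s≤s m≤n) = *-monoʳ-∣ p (^-monoʳ-∣ p m≤n)

  ^-monoˡ-∣ : ∀ {m n} k → m ∣ n → m ^ k ∣ n ^ k
  ^-monoˡ-∣ zero m∣n = ∣-refl
  ^-monoˡ-∣ (suc k) m∣n = *-pres-∣ m∣n (^-monoˡ-∣ k m∣n)

  coprime-*ˡ : ∀ {m n o} → Coprime m o → Coprime n o → Coprime (m * n) o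
  coprime-*ˡ {m} m⊥o n⊥o {d} (d∣mn , d∣o) = n⊥o (coprime-divisor d⊥m d∣mn , d∣o)
    where
    d⊥m : Coprime d m
    d⊥m (e∣d , e∣m) = m⊥o (e∣m , ∣-trans e∣d d∣o)

  coprime-^ˡ : ∀ {m n} k → Coprime m n → Coprime (m ^ k) n
  coprime-^ˡ {n = n} zero _ = 1-coprimeTo n
  coprime-^ˡ (suc k) m⊥n = coprime-*ˡ m⊥n (coprime-^ˡ k m⊥n)

  coprime-^ʳ : ∀ {m n} k → Coprime m n → Coprime m (n ^ k)
  coprime-^ʳ k = Coprimality.sym ∘ coprime-^ˡ k ∘ Coprimality.sym

  coprime-^ : ∀ {m n} j k → Coprime m n → Coprime (m ^ j) (n ^ k)
  coprime-^ j k = coprime-^ˡ j ∘ coprime-^ʳ k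

  coprime⇒*∣ : ∀ {m n o} → Coprime m n → m ∣ o → n ∣ o → m * n ∣ o
  coprime⇒*∣ {m} {n} {o} m⊥n m∣o n∣o = subst (m * n ∣_) (sym o≡m*q) (*-monoʳ-∣ m n∣q)
    where
    q : ℕ
    q = quotient m∣o
    o≡m*q : o ≡ m * q
    o≡m*q = m∣n⇒n≡m*quotient m∣o
    n∣q : n ∣ q
    n∣q = coprime-divisor (Coprimality.sym m⊥n) (subst (n ∣_) o≡m*q n∣o)

  prime>1 : ∀ {p} → Prime p → 1 < p
  prime>1 {p} pp = nonTrivial⇒n>1 p {{prime⇒nonTrivial pp}}

  prime∤⇒coprime : ∀ {p n} → Prime p → ¬ p ∣ n → Coprime p n
  prime∤⇒coprime pp p∤n (d∣p , d∣n) with prime⇒irreducible pp d∣p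
  ... | inj₁ d≡1 = d≡1
  ... | inj₂ refl = contradiction d∣n p∤n

  distinct-primes-coprime : ∀ {p q} → Prime p → Prime q → p ≢ q → Coprime p q
  distinct-primes-coprime {p} {q} pp pq p≢q = prime∤⇒coprime pp p∤q
    where
    p∤q : ¬ p ∣ q
    p∤q p∣q with prime⇒irreducible pq p∣q
    ... | inj₁ refl = ¬prime[1] pp
    ... | inj₂ p≡q = p≢q p≡q

  primeFactor⊎≡1 : ∀ n .{{_ : NonZero n}} → (∃ λ p → Prime p × p ∣ n) ⊎ n ≡ 1
  primeFactor⊎≡1 n with factorise n
  ... | record { factors = [] ; isFactorisation = n≡1 } = inj₂ n≡1
  ... | record { factors = p ∷ ps ; isFactorisation = n≡p*ps ; factorsPrime = pp ∷ _ } =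
    inj₁ (p , pp , subst (p ∣_) (sym n≡p*ps) (m∣m*n (product ps)))

  p^νF∣n : ∀ f p n → p ^ νF f p n ∣ n
  p^νF∣n zero p n = 1∣ n
  p^νF∣n (suc f) zero n = 1∣ n
  p^νF∣n (suc f) (suc zero) n = 1∣ n
  p^νF∣n (suc f) (suc (suc r)) zero = 1∣ 0
  p^νF∣n (suc f) p@(suc (suc r)) (suc n) with p ∣? suc n
  ... | yes p∣n =
    subst (p * p ^ νF f p (suc n / p) ∣_) (m*[n/m]≡n p∣n) (*-monoʳ-∣ p (p^νF∣n f p (suc n / p)))
  ... | no _ = 1∣ suc n

  p^ν∣n : ∀ p n → p ^ ν p n ∣ n
  p^ν∣n p n = p^νF∣n n p n

  νF-maximal : ∀ f {p n e} → 1 < p → .{{_ : NonZero n}} → n ≤ f → p ^ e ∣ n → e ≤ νF f p n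
  νF-maximal f {e = zero} _ _ _ = z≤n
  νF-maximal (suc f) {p@(suc (suc _))} {suc n} {suc e} p>1@(s≤s (s≤s z≤n)) (s≤s n≤f) pᵉ⁺¹∣n
    with p ∣? suc n
  ... | yes p∣n = s≤s (νF-maximal f p>1 {{n/p≢0}} n/p≤f (m*n∣o⇒n∣o/m p (p ^ e) pᵉ⁺¹∣n))
    where
    n/p≢0 : NonZero (suc n / p)
    n/p≢0 = >-nonZero (m≥n⇒m/n>0 (∣⇒≤ p∣n))
    n/p≤f : suc n / p ≤ f
    n/p≤f = ≤-trans (≤-pred (m/n<m (suc n) p p>1)) n≤f
  ... | no p∤n = contradiction (m*n∣⇒m∣ p (p ^ e) pᵉ⁺¹∣n) p∤n

  ν-maximal : ∀ {p n e} → 1 < p → .{{_ : NonZero n}} → p ^ e ∣ n → e ≤ ν p n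
  ν-maximal {n = n} p>1 = νF-maximal n p>1 ≤-refl

  ν-mono-∣ : ∀ {p m n} → 1 < p → .{{_ : NonZero n}} → m ∣ n → ν p m ≤ ν p n
  ν-mono-∣ {p} {m} p>1 m∣n = ν-maximal p>1 (∣-trans (p^ν∣n p m) m∣n)

  primePowers∣⇒∣ : ∀ {m} n .{{_ : NonZero n}} → (∀ {p} → Prime p → p ^ ν p n ∣ m) → n ∣ m
  primePowers∣⇒∣ {m} n = go n (<-wellFounded n)
    where
    go : ∀ n → Acc _<_ n → .{{_ : NonZero n}} → (∀ {p} → Prime p → p ^ ν p n ∣ m) → n ∣ m
    go n (acc rec) pᵛ∣m with primeFactor⊎≡1 n
    ... | inj₂ refl = 1∣ m
    ... | inj₁ (p , pp , p∣n) =
      subst (_∣ m) (sym n≡pᵛ*c) (coprime⇒*∣ pᵛ⊥c (pᵛ∣m pp) (go c (rec c<n) {{c≢0}} qᵛ∣m))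
      where
      pᵛ∣n : p ^ ν p n ∣ n
      pᵛ∣n = p^ν∣n p n
      c : ℕ
      c = quotient pᵛ∣n
      c≢0 : NonZero c
      c≢0 = quotient≢0 pᵛ∣n
      n≡pᵛ*c : n ≡ p ^ ν p n * c
      n≡pᵛ*c = m∣n⇒n≡m*quotient pᵛ∣n
      p∤c : ¬ p ∣ c
      p∤c p∣c = 1+n≰n (ν-maximal (prime>1 pp) (subst (p * p ^ ν p n ∣_) (sym n≡pᵛ*c)
        (∣-trans (∣-reflexive (*-comm p _)) (*-monoʳ-∣ (p ^ ν p n) p∣c))))
      pᵛ⊥c : Coprime (p ^ ν p n) c
      pᵛ⊥c = coprime-^ˡ (ν p n) (prime∤⇒coprime pp p∤c)
      c<n : c < n
      c<n = ≤∧≢⇒< (∣⇒≤ (quotient-∣ pᵛ∣n)) (λ c≡n → p∤c (subst (p ∣_) (sym c≡n) p∣n))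
      qᵛ∣m : ∀ {q} → Prime q → q ^ ν q c ∣ m
      qᵛ∣m {q} pq = ∣-trans (^-monoʳ-∣ q (ν-mono-∣ (prime>1 pq) (quotient-∣ pᵛ∣n))) (pᵛ∣m pq)

  ∤⇒ν≡0 : ∀ {p n} → ¬ p ∣ n → ν p n ≡ 0
  ∤⇒ν≡0 {n = zero} _ = refl
  ∤⇒ν≡0 {zero} {suc n} _ = refl
  ∤⇒ν≡0 {suc zero} {suc n} _ = refl
  ∤⇒ν≡0 {p@(suc (suc _))} {suc n} p∤n with p ∣? suc n
  ... | yes p∣n = contradiction p∣n p∤n
  ... | no _ = refl

  ∈⇒∣prodOver : ∀ {xs x} (f : ℕ → ℕ) → x ∈ xs → f x ∣ prodOver xs f
  ∈⇒∣prodOver f (here refl) = m∣m*n _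
  ∈⇒∣prodOver {y ∷ _} f (there x∈xs) = ∣n⇒∣m*n (f y) (∈⇒∣prodOver f x∈xs)

  prodOver-coprime : ∀ xs {f n} → (∀ {x} → x ∈ xs → Coprime (f x) n) → Coprime (prodOver xs f) n
  prodOver-coprime [] {n = n} _ = 1-coprimeTo n
  prodOver-coprime (x ∷ xs) f⊥n = coprime-*ˡ (f⊥n (here refl)) (prodOver-coprime xs (f⊥n ∘ there))

  prodOver-∣ : ∀ {xs f n} → Unique xs → (∀ {x y} → x ≢ y → Coprime (f x) (f y)) →
               (∀ x → f x ∣ n) → prodOver xs f ∣ n
  prodOver-∣ [] _ _ = 1∣ _
  prodOver-∣ {x ∷ xs} (x∉xs ∷ xs!) f⊥f f∣n =
    coprime⇒*∣ (Coprimality.sym (prodOver-coprime xs (λ y∈xs → f⊥f (≢-sym (lookup x∉xs y∈xs)))))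
      (f∣n x) (prodOver-∣ xs! f⊥f f∣n)

  ellFactor : ℕ → ℕ → ℕ → ℕ
  ellFactor g L p = if isPrime p ∧ not (divides p g) then p ^ ν p L else 1

  γTerm : ℕ → ℕ → ℕ → ℕ
  γTerm g L p = if isPrime p ∧ divides p g then ⌈ ν p L / ν p g ⌉ else 0

  ellFactor-cases : ∀ g L p →
    (Prime p × ¬ p ∣ g × ellFactor g L p ≡ p ^ ν p L) ⊎ ellFactor g L p ≡ 1
  ellFactor-cases g L p with prime? p | p ∣? g
  ... | yes pp | no p∤g = inj₁ (pp , p∤g , refl)
  ... | yes _ | yes _ = inj₂ refl
  ... | no _ | _ = inj₂ refl

  ellFactor-prime∤ : ∀ {g L p} → Prime p → ¬ p ∣ g → ellFactor g L p ≡ p ^ ν p L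
  ellFactor-prime∤ {g} {L} {p} pp p∤g with prime? p | p ∣? g
  ... | yes _ | no _ = refl
  ... | yes _ | yes p∣g = contradiction p∣g p∤g
  ... | no ¬pp | _ = contradiction pp ¬pp

  ellFactor∣L : ∀ g L p → ellFactor g L p ∣ L
  ellFactor∣L g L p with ellFactor-cases g L p
  ... | inj₁ (_ , _ , eq) = subst (_∣ L) (sym eq) (p^ν∣n p L)
  ... | inj₂ eq = subst (_∣ L) (sym eq) (1∣ L)

  ellFactor-coprime : ∀ g L p → Coprime (ellFactor g L p) g
  ellFactor-coprime g L p with ellFactor-cases g L p
  ... | inj₁ (pp , p∤g , eq) =
    subst (λ f → Coprime f g) (sym eq) (coprime-^ˡ (ν p L) (prime∤⇒coprime pp p∤g))
  ... | inj₂ eq = subst (λ f → Coprime f g) (sym eq) (1-coprimeTo g)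

  ellFactor-pairwiseCoprime : ∀ g L {p q} → p ≢ q → Coprime (ellFactor g L p) (ellFactor g L q)
  ellFactor-pairwiseCoprime g L {p} {q} p≢q with ellFactor-cases g L p | ellFactor-cases g L q
  ... | inj₂ eq | _ rewrite eq = 1-coprimeTo _
  ... | inj₁ _ | inj₂ eq rewrite eq = Coprimality.sym (1-coprimeTo _)
  ... | inj₁ (pp , _ , eqp) | inj₁ (pq , _ , eqq) rewrite eqp | eqq =
    coprime-^ (ν p L) (ν q L) (distinct-primes-coprime pp pq p≢q)

  ell∣L : ∀ g L → ell g L ∣ L
  ell∣L g L = prodOver-∣ (upTo⁺ (suc L)) (ellFactor-pairwiseCoprime g L) (ellFactor∣L g L)

  ell-coprime : ∀ g L → Coprime (ell g L) g
  ell-coprime g L = prodOver-coprime (upTo (suc L)) (λ {p} _ → ellFactor-coprime g L p)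

  p^ν∣ell : ∀ {g L p} .{{_ : NonZero L}} → Prime p → ¬ p ∣ g → p ^ ν p L ∣ ell g L
  p^ν∣ell {g} {L} {p} pp p∤g with p ∣? L
  ... | no p∤L rewrite ∤⇒ν≡0 p∤L = 1∣ ell g L
  ... | yes p∣L = subst (_∣ ell g L) (ellFactor-prime∤ {L = L} pp p∤g)
    (∈⇒∣prodOver (ellFactor g L) (∈-upTo⁺ (s≤s (∣⇒≤ p∣L))))

  ⌈/⌉≤⇒≤* : ∀ m n c → ⌈ m / suc n ⌉ ≤ c → m ≤ c * suc n
  ⌈/⌉≤⇒≤* m n c ⌈m/n⌉≤c = ≤-trans m≤q*[1+n] (*-monoˡ-≤ (suc n) ⌈m/n⌉≤c)
    where
    q = (m + n) / suc n
    m≤q*[1+n] : m ≤ q * suc n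
    m≤q*[1+n] = +-cancelʳ-≤ n m (q * suc n) (begin
      m + n                       ≡⟨ m≡m%n+[m/n]*n (m + n) (suc n) ⟩
      (m + n) % suc n + q * suc n ≤⟨ +-monoˡ-≤ (q * suc n) (≤-pred (m%n<n (m + n) (suc n))) ⟩
      n + q * suc n               ≡⟨ +-comm n (q * suc n) ⟩
      q * suc n + n               ∎)
      where open ≤-Reasoning

  f≤maxOver : ∀ {xs x} (f : ℕ → ℕ) → x ∈ xs → f x ≤ maxOver xs f
  f≤maxOver f (here refl) = m≤m⊔n _ _
  f≤maxOver {y ∷ _} f (there x∈xs) = ≤-trans (f≤maxOver f x∈xs) (m≤n⊔m (f y) _)

  ⌈ν/ν⌉≤γ : ∀ {g L p} .{{_ : NonZero g}} → Prime p → p ∣ g → ⌈ ν p L / ν p g ⌉ ≤ γ g L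
  ⌈ν/ν⌉≤γ {g} {L} {p} pp p∣g
    with prime? p | p ∣? g | f≤maxOver (γTerm g L) (∈-upTo⁺ (s≤s (∣⇒≤ p∣g)))
  ... | yes _ | yes _ | term≤γ = term≤γ
  ... | yes _ | no p∤g | _ = contradiction p∣g p∤g
  ... | no ¬pp | _ | _ = contradiction pp ¬pp

  p^ν∣g^κ : ∀ {g L κ p} .{{_ : NonZero g}} → γ g L ≤ κ → Prime p → p ∣ g → p ^ ν p L ∣ g ^ κ
  p^ν∣g^κ {g} {L} {κ} {p} γ≤κ pp p∣g = begin
    p ^ ν p L       ∣⟨ ^-monoʳ-∣ p νL≤νg*κ ⟩
    p ^ (ν p g * κ) ≡⟨ ^-*-assoc p (ν p g) κ ⟨
    (p ^ ν p g) ^ κ ∣⟨ ^-monoˡ-∣ κ (p^ν∣n p g) ⟩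
    g ^ κ           ∎
    where
    open ∣-Reasoning
    νL≤νg*κ : ν p L ≤ ν p g * κ
    νL≤νg*κ with ν p g | ν-maximal {e = 1} (prime>1 pp) (subst (_∣ g) (sym (*-identityʳ p)) p∣g)
               | ⌈ν/ν⌉≤γ {L = L} pp p∣g
    ... | zero | () | _
    ... | suc k | _ | ⌈νL/νg⌉≤γ =
      subst (ν p L ≤_) (*-comm κ (suc k)) (⌈/⌉≤⇒≤* (ν p L) k κ (≤-trans ⌈νL/νg⌉≤γ γ≤κ))

  L∣g^κ*ell : ∀ {g L κ} .{{_ : NonZero g}} .{{_ : NonZero L}} → γ g L ≤ κ → L ∣ g ^ κ * ell g L
  L∣g^κ*ell {g} {L} {κ} γ≤κ = primePowers∣⇒∣ L pᵛ∣g^κ*ell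
    where
    pᵛ∣g^κ*ell : ∀ {p} → Prime p → p ^ ν p L ∣ g ^ κ * ell g L
    pᵛ∣g^κ*ell {p} pp with p ∣? g
    ... | yes p∣g = ∣m⇒∣m*n (ell g L) (p^ν∣g^κ {L = L} γ≤κ pp p∣g)
    ... | no p∤g = ∣n⇒∣m*n (g ^ κ) (p^ν∣ell pp p∤g)

module PowerSums where

  open import Data.Integer using (ℤ; +_; _+_; _-_; _*_; _^_; ∣_∣)
  open import Data.Integer.Properties using (abs-*; *-identityʳ; *-distribˡ-+; ^-*-assoc)
  open import Data.Integer.Divisibility.Signed
  import Data.Integer.Divisibility as Unsigned
  open import Data.Integer.Solver using (module +-*-Solver)
  import Data.Nat as ℕ
  import Data.Nat.Properties as ℕ
  open import Data.Product using (Σ; _×_; _,_)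
  open import Relation.Binary.PropositionalEquality

  ∣i^n∣≡∣i∣^n : ∀ i n → ∣ i ^ n ∣ ≡ ∣ i ∣ ℕ.^ n
  ∣i^n∣≡∣i∣^n i ℕ.zero = refl
  ∣i^n∣≡∣i∣^n i (ℕ.suc n) = trans (abs-* i (i ^ n)) (cong (∣ i ∣ ℕ.*_) (∣i^n∣≡∣i∣^n i n))

  ^-distribʳ-* : ∀ i j n → (i * j) ^ n ≡ i ^ n * j ^ n
  ^-distribʳ-* i j ℕ.zero = refl
  ^-distribʳ-* i j (ℕ.suc n) = begin
    i * j * (i * j) ^ n     ≡⟨ cong (i * j *_) (^-distribʳ-* i j n) ⟩
    i * j * (i ^ n * j ^ n) ≡⟨ interchange i j (i ^ n) (j ^ n) ⟩
    i * i ^ n * (j * j ^ n) ∎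
    where
    open ≡-Reasoning
    open +-*-Solver
    interchange : ∀ a b c d → a * b * (c * d) ≡ a * c * (b * d)
    interchange = solve 4 (λ a b c d → a :* b :* (c :* d) := a :* c :* (b :* d)) refl

  ∣[c*x]^n+[c*y]^n∣≡∣c∣^n*∣x^n+y^n∣ : ∀ c x y n →
    ∣ (c * x) ^ n + (c * y) ^ n ∣ ≡ ∣ c ∣ ℕ.^ n ℕ.* ∣ x ^ n + y ^ n ∣
  ∣[c*x]^n+[c*y]^n∣≡∣c∣^n*∣x^n+y^n∣ c x y n = begin
    ∣ (c * x) ^ n + (c * y) ^ n ∣     ≡⟨ cong ∣_∣ (cong₂ _+_ (^-distribʳ-* c x n) (^-distribʳ-* c y n)) ⟩
    ∣ c ^ n * x ^ n + c ^ n * y ^ n ∣ ≡⟨ cong ∣_∣ (*-distribˡ-+ (c ^ n) (x ^ n) (y ^ n)) ⟨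
    ∣ c ^ n * (x ^ n + y ^ n) ∣       ≡⟨ abs-* (c ^ n) (x ^ n + y ^ n) ⟩
    ∣ c ^ n ∣ ℕ.* ∣ x ^ n + y ^ n ∣   ≡⟨ cong (ℕ._* ∣ x ^ n + y ^ n ∣) (∣i^n∣≡∣i∣^n c n) ⟩
    ∣ c ∣ ℕ.^ n ℕ.* ∣ x ^ n + y ^ n ∣ ∎
    where open ≡-Reasoning

  x+y∣x^[2+n]+y^[2+n] : ∀ x y n → x + y ∣ x ^ n + y ^ n → x + y ∣ x ^ (2 ℕ.+ n) + y ^ (2 ℕ.+ n)
  x+y∣x^[2+n]+y^[2+n] x y n x+y∣x^n+y^n = subst (x + y ∣_) (sym (identity x y (x ^ n) (y ^ n)))
    (∣m∣n⇒∣m-n (∣n⇒∣m*n (x * x) x+y∣x^n+y^n) (∣n⇒∣m*n (y ^ n * (x - y)) ∣-refl))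
    where
    open +-*-Solver
    identity : ∀ x y X Y → x * (x * X) + y * (y * Y) ≡ x * x * (X + Y) - Y * (x - y) * (x + y)
    identity = solve 4 (λ x y X Y →
      x :* (x :* X) :+ y :* (y :* Y) := x :* x :* (X :+ Y) :- Y :* (x :- y) :* (x :+ y)) refl

  x+y∣x^[1+2n]+y^[1+2n] : ∀ x y n → x + y ∣ x ^ ℕ.suc (2 ℕ.* n) + y ^ ℕ.suc (2 ℕ.* n)
  x+y∣x^[1+2n]+y^[1+2n] x y ℕ.zero =
    ∣-reflexive (cong₂ _+_ (sym (*-identityʳ x)) (sym (*-identityʳ y)))
  x+y∣x^[1+2n]+y^[1+2n] x y (ℕ.suc n) =
    subst (λ k → x + y ∣ x ^ ℕ.suc k + y ^ ℕ.suc k) (sym (ℕ.*-suc 2 n))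
      (x+y∣x^[2+n]+y^[2+n] x y (ℕ.suc (2 ℕ.* n)) (x+y∣x^[1+2n]+y^[1+2n] x y n))

  Good⇒exponent≥ : ∀ {x y M} n → Good x y M →
    Σ ℕ.ℕ λ κ → 1 ℕ.≤ κ × n ℕ.≤ κ × + M Unsigned.∣ x ^ κ + y ^ κ
  Good⇒exponent≥ {x} {y} {M} n (K , 1≤K , M∣x^K+y^K) =
    K ℕ.* m , ℕ.*-mono-≤ 1≤K (ℕ.s≤s ℕ.z≤n) , n≤K*m ,
    ∣⇒∣ᵤ (∣-trans (∣ᵤ⇒∣ {+ M} M∣x^K+y^K) x^K+y^K∣x^Km+y^Km)
    where
    m : ℕ.ℕ
    m = ℕ.suc (2 ℕ.* n)
    x^K+y^K∣x^Km+y^Km : x ^ K + y ^ K ∣ x ^ (K ℕ.* m) + y ^ (K ℕ.* m)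
    x^K+y^K∣x^Km+y^Km = subst (x ^ K + y ^ K ∣_) (cong₂ _+_ (^-*-assoc x K m) (^-*-assoc y K m))
      (x+y∣x^[1+2n]+y^[1+2n] (x ^ K) (y ^ K) n)
    n≤K*m : n ℕ.≤ K ℕ.* m
    n≤K*m = ℕ.≤-trans (ℕ.≤-trans (ℕ.m≤n*m n 2) (ℕ.n≤1+n _)) (ℕ.m≤n*m m K {{ℕ.>-nonZero 1≤K}})

open import Data.Integer using (ℤ; +_; _*_; _+_; _^_; ∣_∣)
open import Data.Integer.Divisibility using (_∣_)
open import Data.Integer.Properties using (∣i∣≡0⇒i≡0)
open import Data.Nat using (ℕ; _≤_)
import Data.Nat as ℕ
import Data.Nat.Coprimality as ℕ
import Data.Nat.Divisibility as ℕ
open import Data.Nat.GCD using (gcd)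
import Data.Nat.GCD as ℕ
import Data.Nat.Properties as ℕ
open import Data.Product using (Σ; _×_; _,_)
open import Function using (_∘_)
open import Function.Bundles using (_⇔_; mk⇔)
open import Relation.Binary.PropositionalEquality using (_≡_; _≢_; sym; subst; subst₂)
open PrimePowers using (coprime-^ʳ; ell∣L; ell-coprime; L∣g^κ*ell)
open PowerSums using (∣[c*x]^n+[c*y]^n∣≡∣c∣^n*∣x^n+y^n∣; Good⇒exponent≥)

Good-scaled⇒Good-ell : ∀ {g L a b} → Good (+ g * a) (+ g * b) L → Good a b (ell g L)
Good-scaled⇒Good-ell {g} {L} {a} {b} (K , 1≤K , L∣[ga]ᴷ+[gb]ᴷ) = K , 1≤K ,
  ℕ.coprime-divisor (coprime-^ʳ K (ell-coprime g L)) (ℕ.∣-trans (ell∣L g L) L∣gᴷ*[aᴷ+bᴷ])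
  where
  L∣gᴷ*[aᴷ+bᴷ] : L ℕ.∣ g ℕ.^ K ℕ.* ∣ a ^ K + b ^ K ∣
  L∣gᴷ*[aᴷ+bᴷ] = subst (L ℕ.∣_) (∣[c*x]^n+[c*y]^n∣≡∣c∣^n*∣x^n+y^n∣ (+ g) a b K) L∣[ga]ᴷ+[gb]ᴷ

Good-ell⇒Good-scaled : ∀ {g L a b κ} .{{_ : ℕ.NonZero g}} .{{_ : ℕ.NonZero L}} →
  1 ≤ κ → γ g L ≤ κ → + ell g L ∣ a ^ κ + b ^ κ → Good (+ g * a) (+ g * b) L
Good-ell⇒Good-scaled {g} {L} {a} {b} {κ} 1≤κ γ≤κ ell∣ = κ , 1≤κ ,
  subst (L ℕ.∣_) (sym (∣[c*x]^n+[c*y]^n∣≡∣c∣^n*∣x^n+y^n∣ (+ g) a b κ))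
    (ℕ.∣-trans (L∣g^κ*ell γ≤κ) (ℕ.*-monoʳ-∣ (g ℕ.^ κ) ell∣))

theorem3p4 : (A B : ℤ) → A ≢ + 0 → B ≢ + 0 →
    (a b : ℤ) → A ≡ + gcd ∣ A ∣ ∣ B ∣ * a → B ≡ + gcd ∣ A ∣ ∣ B ∣ * b →
    (L : ℕ) → 2 ≤ L →
    (Good A B L ⇔ Σ ℕ (λ κ → 1 ≤ κ × γ (gcd ∣ A ∣ ∣ B ∣) L ≤ κ × (+ ell (gcd ∣ A ∣ ∣ B ∣) L) ∣ ((a ^ κ) + (b ^ κ))))
    × (Good A B L ⇔ Good a b (ell (gcd ∣ A ∣ ∣ B ∣) L))
theorem3p4 A B A≢0 _ a b A≡ga B≡gb L 2≤L = mk⇔ (iii⇒ii ∘ i⇒iii) ii⇒i , mk⇔ i⇒iii (ii⇒i ∘ iii⇒ii)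
  where
  g : ℕ
  g = gcd ∣ A ∣ ∣ B ∣
  instance
    g≢0 : ℕ.NonZero g
    g≢0 = ℕ.≢-nonZero (A≢0 ∘ ∣i∣≡0⇒i≡0 ∘ ℕ.gcd[m,n]≡0⇒m≡0)
    L≢0 : ℕ.NonZero L
    L≢0 = ℕ.>-nonZero (ℕ.≤-trans (ℕ.s≤s ℕ.z≤n) 2≤L)

  i⇒iii : Good A B L → Good a b (ell g L)
  i⇒iii = Good-scaled⇒Good-ell ∘ subst₂ (λ X Y → Good X Y L) A≡ga B≡gb

  iii⇒ii : Good a b (ell g L) → Σ ℕ (λ κ → 1 ≤ κ × γ g L ≤ κ × + ell g L ∣ a ^ κ + b ^ κ)
  iii⇒ii = Good⇒exponent≥ (γ g L)

  ii⇒i : Σ ℕ (λ κ → 1 ≤ κ × γ g L ≤ κ × + ell g L ∣ a ^ κ + b ^ κ) → Good A B L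
  ii⇒i (κ , 1≤κ , γ≤κ , ell∣) =
    subst₂ (λ X Y → Good X Y L) (sym A≡ga) (sym B≡gb) (Good-ell⇒Good-scaled 1≤κ γ≤κ ell∣)
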